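{- Let $t \ge 3$ and $n \ge 3$ be integers and let $W_n = C_n + K_1$ be the wheel. Then $M_t(W_n)$ is not a distance magic graph.
   Context: $C_n + K_1$ denotes the join of the cycle $C_n$ with a single vertex (the wheel with $n$ rim vertices). For a graph $G=(V,E)$ and an integer $t \ge 1$, the generalised Mycielskian $M_t(G)$ is the graph with vertex set $(V \times \{0,1,\dots,t-1\}) \cup \{u\}$ (where $u$ is a new vertex), whose edges are: $(x,0)(y,0)$ for every edge $xy \in E$; $(x,i)(y,i+1)$ for every $0 \le i \le t-2$ and every ordered pair $(x,y)$ with $xy \in E$; and $(x,t-1)u$ for every $x \in V$. A graph $H$ on $N$ vertices is distance magic if there is a bijection $f: V(H) \to \{1,2,\dots,N\}$ and a constant $k$ such that for every vertex $v$, $\sum_{w \in N(v)} f(w) = k$, where $N(v)$ is the open neighbourhood of $v$. -}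

module Defs where

open import Data.Nat using (ℕ; zero; suc; _+_; _*_; _≥_; _≡ᵇ_)
open import Data.Fin using (Fin; toℕ)
open import Data.Bool using (Bool; true; false; _∧_; _∨_; if_then_else_; not)
open import Data.Product using (Σ; _×_; _,_)
open import Data.Sum using (_⊎_; inj₁; inj₂)
open import Data.Unit using (⊤; tt)
open import Data.List using (List; map; allFin)
open import Data.Nat.ListAction using (sum)
open import Function.Bundles using (_↔_; Inverse)
open import Function.Properties.Inverse using (↔-sym; ↔-trans)
open import Data.Fin.Properties using (+↔⊎; *↔×; 1↔⊤)
open import Data.Sum.Function.Propositional using (_⊎-↔_)
open import Data.Product.Function.NonDependent.Propositional using (_×-↔_)
open import Function.Properties.Inverse using (↔-refl)
open import Relation.Binary.PropositionalEquality using (_≡_)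
open import Function.Definitions using (Bijective)

-- A finite simple graph: a vertex type V with an enumeration V ↔ Fin N,
-- and a Boolean adjacency relation.  (The concrete graphs built below are
-- symmetric and loopless; this is not needed to state distance magic.)
record Graph : Set₁ where
  field
    V     : Set
    N     : ℕ
    enum  : V ↔ Fin N
    adj   : V → V → Bool
open Graph public

nbrSum : (G : Graph) → (V G → ℕ) → V G → ℕ
nbrSum G f v = sum (map (λ i → let w = Inverse.from (enum G) i in
                                if adj G v w then f w else 0) (allFin (N G)))

-- Distance magic: a bijection f : V → {1,…,N} (encoded as a bijection V → Fin N,
-- label of w being toℕ (f w) + 1) and a constant k with Σ_{w ∈ N(v)} f(w) = k for all v.
DistanceMagic : Graph → Set
DistanceMagic G =
  Σ (V G → Fin (N G)) λ f →
    Bijective _≡_ _≡_ f × Σ ℕ (λ k → ∀ v → nbrSum G (λ w → suc (toℕ (f w))) v ≡ k)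

eqFin : ∀ {n} → Fin n → Fin n → Bool
eqFin a b = toℕ a ≡ᵇ toℕ b

-- Wheel W_n = C_n + K_1 with vertices ⊤ (hub) ⊎ Fin n (rim, cyclically ordered).
-- Rim vertices i, j are adjacent iff j ≡ i+1 or i ≡ j+1 (mod n).
cycAdj : (n : ℕ) → Fin n → Fin n → Bool
cycAdj n i j = nextOf i j ∨ nextOf j i
  where
  nextOf : Fin n → Fin n → Bool
  -- (toℕ a + 1) mod n == toℕ b, written without division:
  nextOf a b = (suc (toℕ a) ≡ᵇ toℕ b) ∨ ((suc (toℕ a) ≡ᵇ n) ∧ (toℕ b ≡ᵇ 0))

wheelAdj : (n : ℕ) → (⊤ ⊎ Fin n) → (⊤ ⊎ Fin n) → Bool
wheelAdj n (inj₁ _) (inj₁ _) = false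
wheelAdj n (inj₁ _) (inj₂ _) = true
wheelAdj n (inj₂ _) (inj₁ _) = true
wheelAdj n (inj₂ i) (inj₂ j) = cycAdj n i j

mycAdj : {V : Set} (t : ℕ) → (V → V → Bool) →
         (V × Fin t) ⊎ ⊤ → (V × Fin t) ⊎ ⊤ → Bool
mycAdj t a (inj₁ (x , i)) (inj₁ (y , j)) =
  a x y ∧ (((toℕ i ≡ᵇ 0) ∧ (toℕ j ≡ᵇ 0)) ∨ (suc (toℕ i) ≡ᵇ toℕ j) ∨ (suc (toℕ j) ≡ᵇ toℕ i))
mycAdj t a (inj₁ (x , i)) (inj₂ _) = suc (toℕ i) ≡ᵇ t
mycAdj t a (inj₂ _) (inj₁ (y , j)) = suc (toℕ j) ≡ᵇ t
mycAdj t a (inj₂ _) (inj₂ _) = false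

Wheel : ℕ → Graph
Wheel n = record
  { V    = ⊤ ⊎ Fin n
  ; N    = 1 + n
  ; enum = ↔-trans (↔-sym 1↔⊤ ⊎-↔ ↔-refl) (↔-sym +↔⊎)
  ; adj  = wheelAdj n
  }

Mycielskian : ℕ → Graph → Graph
Mycielskian t G = record
  { V    = (V G × Fin t) ⊎ ⊤
  ; N    = N G * t + 1
  ; enum = ↔-trans ((↔-trans (enum G ×-↔ ↔-refl) (↔-sym *↔×)) ⊎-↔ ↔-sym 1↔⊤) (↔-sym +↔⊎)
  ; adj  = mycAdj t (adj G)
  }

{-# OPTIONS --safe #-}
-- In M_t(W_n) with t ≥ 3 the vertices (x , 0) and (x , 1) have the neighbourhoods
-- N(x) × {0, 1} and N(x) × {0, 2}, so equal magic sums force every vertex x of the wheel to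
-- see the same total label in layer 1 as in layer 2.  On the wheel the neighbourhood sums
-- determine the label of the hub: the rim vertices' sums add up to n times the hub label
-- plus twice the rim total, and the rim total is the hub's own sum.  Hence the copies of the
-- hub in layers 1 and 2 receive the same label, contradicting injectivity.

module Submission where

open import Defs
open import Data.Bool using (Bool; true; false; T; _∧_; _∨_; if_then_else_)
open import Data.Bool.Properties using (T-∧; T-∨)
open import Data.Fin using (Fin; zero; suc; toℕ; splitAt; remQuot; quotRem; punchIn; fromℕ; fromℕ<; inject₁)
open import Data.Fin.Properties
  using (punchInᵢ≢i; toℕ-fromℕ; toℕ-inject₁; toℕ-fromℕ<; toℕ<n; toℕ-injective)
open import Data.List using (map; allFin; tabulate)
open import Data.List.Properties using (map-tabulate)
open import Data.Nat using (ℕ; zero; suc; _+_; _*_; _≡ᵇ_; _<_; _≥_; _≟_; s≤s)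
import Data.Nat.ListAction as List
open import Data.Nat.Properties
  using ( +-0-commutativeMonoid; +-assoc; +-identityʳ; +-cancelˡ-≡; +-cancelʳ-≡; *-cancelˡ-≡
        ; ≡ᵇ⇒≡; ≡⇒≡ᵇ; suc-injective; <⇒≢; m≢1+n+m; ≤∧≢⇒< )
open import Data.Product as Product using (Σ; _×_; _,_; proj₁; proj₂; swap; map₂)
open import Data.Sum as Sum using (_⊎_; inj₁; inj₂; [_,_]′; map₁)
open import Data.Sum.Properties using ([,]-∘)
open import Data.Unit using (tt)
open import Data.Vec.Functional using (removeAt)
open import Function using (_∘_)
open import Function.Bundles using (Equivalence; Inverse)
open import Relation.Nullary using (¬_; contradiction; yes; no)
open import Relation.Binary.PropositionalEquality
open import Algebra.Properties.CommutativeMonoid.Sum +-0-commutativeMonoid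
  using (sum; sum-syntax; sum-cong-≗; sum-remove; sum-replicate-zero; ∑-distrib-+; ∑-comm)

if-T : ∀ {b} c → T b → (if b then c else 0) ≡ c
if-T {true} c _ = refl

if-¬T : ∀ {b} c → ¬ T b → (if b then c else 0) ≡ 0
if-¬T {true}  c ¬b = contradiction _ ¬b
if-¬T {false} c _  = refl

if-∨ : ∀ {a b} c → ¬ (T a × T b) → (if a ∨ b then c else 0) ≡ (if a then c else 0) + (if b then c else 0)
if-∨ {true}  {true}  c ¬ab = contradiction _ ¬ab
if-∨ {true}  {false} c _   = sym (+-identityʳ c)
if-∨ {false} {b}     c _   = refl

sum-tabulate : ∀ {m} (g : Fin m → ℕ) → List.sum (tabulate g) ≡ sum g
sum-tabulate {zero}  g = refl
sum-tabulate {suc m} g = cong (g zero +_) (sum-tabulate (g ∘ suc))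

sum-allFin : ∀ {m} (g : Fin m → ℕ) → List.sum (map g (allFin m)) ≡ sum g
sum-allFin g = trans (cong List.sum (map-tabulate (λ i → i) g)) (sum-tabulate g)

∑-const : ∀ m c → ∑[ i < m ] c ≡ m * c
∑-const zero    c = refl
∑-const (suc m) c = cong (c +_) (∑-const m c)

∑-splitAt : ∀ m {n} (h : Fin m ⊎ Fin n → ℕ) →
            ∑[ i < m + n ] h (splitAt m i) ≡ ∑[ i < m ] h (inj₁ i) + ∑[ j < n ] h (inj₂ j)
∑-splitAt zero    h = refl
∑-splitAt (suc m) h =
  trans (cong (h (inj₁ zero) +_) (∑-splitAt m (h ∘ map₁ suc))) (sym (+-assoc (h (inj₁ zero)) _ _))

∑-remQuot : ∀ m n (h : Fin m × Fin n → ℕ) →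
            ∑[ i < m * n ] h (remQuot n i) ≡ ∑[ a < m ] ∑[ b < n ] h (a , b)
∑-remQuot zero    n h = refl
∑-remQuot (suc m) n h =
  trans (∑-splitAt n (h ∘ swap ∘ [ (_, zero) , map₂ suc ∘ quotRem {m} n ]′))
        (cong (∑[ b < n ] h (zero , b) +_) (∑-remQuot m n (λ (a , b) → h (suc a , b))))

∑-indicator : ∀ {m} (P : Fin m → Bool) c (p : Fin m) → T (P p) → (∀ q → T (P q) → q ≡ p) →
              ∑[ q < m ] (if P q then c else 0) ≡ c
∑-indicator {suc m} P c p Pp unique = begin
  ∑[ q < suc m ] ind q                           ≡⟨ sum-remove {i = p} ind ⟩
  ind p + sum (removeAt ind p)                   ≡⟨ cong₂ _+_ (if-T c Pp) (sum-cong-≗ off-p) ⟩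
  c + ∑[ _ < m ] 0                               ≡⟨ cong (c +_) (sum-replicate-zero m) ⟩
  c + 0                                          ≡⟨ +-identityʳ c ⟩
  c                                              ∎
  where
  open ≡-Reasoning
  ind = λ q → if P q then c else 0
  off-p : ∀ q → ind (punchIn p q) ≡ 0
  off-p q = if-¬T c (punchInᵢ≢i p q ∘ unique (punchIn p q))

vertex : (G : Graph) → Fin (N G) → V G
vertex G = Inverse.from (enum G)

nbrSum-∑ : (G : Graph) (f : V G → ℕ) (v : V G) →
           nbrSum G f v ≡ ∑[ i < N G ] (if adj G v (vertex G i) then f (vertex G i) else 0)
nbrSum-∑ G f v = sum-allFin (λ i → if adj G v (vertex G i) then f (vertex G i) else 0)

-- The layer condition inside Defs.mycAdj: adj (Mycielskian t G) (inj₁ (x , i)) (inj₁ (y , j))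
-- unfolds to adj G x y ∧ layersAdjacent i j.
layersAdjacent : ∀ {t} → Fin t → Fin t → Bool
layersAdjacent i j =
  ((toℕ i ≡ᵇ 0) ∧ (toℕ j ≡ᵇ 0)) ∨ (suc (toℕ i) ≡ᵇ toℕ j) ∨ (suc (toℕ j) ≡ᵇ toℕ i)

module _ (t : ℕ) (G : Graph) where
  private
    M = Mycielskian t G

  ∑-Mycielskian : (h : V M → ℕ) →
    ∑[ i < N M ] h (vertex M i) ≡ ∑[ a < N G ] ∑[ j < t ] h (inj₁ (vertex G a , j)) + (h (inj₂ tt) + 0)
  ∑-Mycielskian h =
    trans (sum-cong-≗ ([,]-∘ h ∘ splitAt (N G * t)))
          (trans (∑-splitAt (N G * t) [ h ∘ inj₁ ∘ copy ∘ remQuot {N G} t , (λ _ → h (inj₂ tt)) ]′)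
                 (cong (_+ (h (inj₂ tt) + 0)) (∑-remQuot (N G) t (h ∘ inj₁ ∘ copy))))
    where
    copy : Fin (N G) × Fin t → V G × Fin t
    copy (a , j) = vertex G a , j

  layer : (V M → ℕ) → Fin t → V G → ℕ
  layer f j y = f (inj₁ (y , j))

  nbrSum-Mycielskian-layer : (f : V M → ℕ) (x : V G) (i j₁ j₂ : Fin t) → suc (toℕ i) ≢ t →
    (∀ a (g : Fin t → ℕ) →
       ∑[ j < t ] (if a ∧ layersAdjacent i j then g j else 0) ≡ (if a then g j₁ else 0) + (if a then g j₂ else 0)) →
    nbrSum M f (inj₁ (x , i)) ≡ nbrSum G (layer f j₁) x + nbrSum G (layer f j₂) x
  nbrSum-Mycielskian-layer f x i j₁ j₂ notLast twoLayers = begin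
    nbrSum M f (inj₁ (x , i))
      ≡⟨ trans (nbrSum-∑ M f (inj₁ (x , i))) (∑-Mycielskian nbr) ⟩
    total + (nbr (inj₂ tt) + 0)
      ≡⟨ cong (λ z → total + (z + 0)) (if-¬T (f (inj₂ tt)) (notLast ∘ ≡ᵇ⇒≡ _ _)) ⟩
    total + 0
      ≡⟨ +-identityʳ total ⟩
    ∑[ a < N G ] ∑[ j < t ] summand a j
      ≡⟨ sum-cong-≗ (λ a → twoLayers (adj G x (y a)) (λ j → layer f j (y a))) ⟩
    ∑[ a < N G ] (layerSummand j₁ a + layerSummand j₂ a)
      ≡⟨ ∑-distrib-+ (layerSummand j₁) (layerSummand j₂) ⟩
    ∑[ a < N G ] layerSummand j₁ a + ∑[ a < N G ] layerSummand j₂ a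
      ≡⟨ cong₂ _+_ (nbrSum-∑ G (layer f j₁) x) (nbrSum-∑ G (layer f j₂) x) ⟨
    nbrSum G (layer f j₁) x + nbrSum G (layer f j₂) x ∎
    where
    open ≡-Reasoning
    y = vertex G
    nbr : V M → ℕ
    nbr w = if adj M (inj₁ (x , i)) w then f w else 0
    summand : Fin (N G) → Fin t → ℕ
    summand a j = if adj G x (y a) ∧ layersAdjacent i j then layer f j (y a) else 0
    layerSummand : Fin t → Fin (N G) → ℕ
    layerSummand j a = if adj G x (y a) then layer f j (y a) else 0
    total : ℕ
    total = ∑[ a < N G ] ∑[ j < t ] summand a j

module _ {t′ : ℕ} where
  private
    t = 3 + t′

  ∑-neighbourLayers-0 : ∀ (a : Bool) (g : Fin t → ℕ) →
    ∑[ j < t ] (if a ∧ layersAdjacent zero j then g j else 0)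
      ≡ (if a then g zero else 0) + (if a then g (suc zero) else 0)
  ∑-neighbourLayers-0 false g = cong (λ z → 0 + (0 + (0 + z))) (sum-replicate-zero t′)
  ∑-neighbourLayers-0 true  g =
    cong (g zero +_) (trans (cong (λ z → g (suc zero) + (0 + z)) (sum-replicate-zero t′))
                            (+-identityʳ (g (suc zero))))

  ∑-neighbourLayers-1 : ∀ (a : Bool) (g : Fin t → ℕ) →
    ∑[ j < t ] (if a ∧ layersAdjacent (suc zero) j then g j else 0)
      ≡ (if a then g zero else 0) + (if a then g (suc (suc zero)) else 0)
  ∑-neighbourLayers-1 false g = cong (λ z → 0 + (0 + (0 + z))) (sum-replicate-zero t′)
  ∑-neighbourLayers-1 true  g =
    cong (g zero +_) (trans (cong (λ z → 0 + (g (suc (suc zero)) + z)) (sum-replicate-zero t′))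
                            (+-identityʳ (g (suc (suc zero)))))

  magic⇒nbrSum-layer₁≡nbrSum-layer₂ : (G : Graph) (f : V (Mycielskian t G) → ℕ) (k : ℕ) →
    (∀ v → nbrSum (Mycielskian t G) f v ≡ k) →
    ∀ x → nbrSum G (layer t G f (suc zero)) x ≡ nbrSum G (layer t G f (suc (suc zero))) x
  -- The (λ ()) arguments are where t ≥ 3 is used: layers 0 and 1 are not the last one,
  -- so neither (x , 0) nor (x , 1) is adjacent to u.
  magic⇒nbrSum-layer₁≡nbrSum-layer₂ G f k magic x = +-cancelˡ-≡ (around zero) _ _ (begin
    around zero + around (suc zero)
      ≡⟨ nbrSum-Mycielskian-layer t G f x zero zero (suc zero) (λ ()) ∑-neighbourLayers-0 ⟨
    nbrSum (Mycielskian t G) f (inj₁ (x , zero))       ≡⟨ magic (inj₁ (x , zero)) ⟩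
    k                                                  ≡⟨ magic (inj₁ (x , suc zero)) ⟨
    nbrSum (Mycielskian t G) f (inj₁ (x , suc zero))
      ≡⟨ nbrSum-Mycielskian-layer t G f x (suc zero) zero (suc (suc zero)) (λ ()) ∑-neighbourLayers-1 ⟩
    around zero + around (suc (suc zero)) ∎)
    where
    open ≡-Reasoning
    around : Fin t → ℕ
    around j = nbrSum G (layer t G f j) x

-- The successor test modulo m written inline in Defs.cycAdj, so that cycAdj n i j unfolds to
-- isSucc n (toℕ i) (toℕ j) ∨ isSucc n (toℕ j) (toℕ i).
isSucc : ℕ → ℕ → ℕ → Bool
isSucc m a b = (suc a ≡ᵇ b) ∨ ((suc a ≡ᵇ m) ∧ (b ≡ᵇ 0))

isSucc-view : ∀ m a b → T (isSucc m a b) → suc a ≡ b ⊎ (suc a ≡ m × b ≡ 0)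
isSucc-view m a b s =
  Sum.map (≡ᵇ⇒≡ _ _) (Product.map (≡ᵇ⇒≡ _ _) (≡ᵇ⇒≡ _ _) ∘ Equivalence.to T-∧)
               (Equivalence.to T-∨ s)

isSucc-step : ∀ m {a b} → suc a ≡ b → T (isSucc m a b)
isSucc-step m {a} refl = Equivalence.from T-∨ (inj₁ (≡⇒≡ᵇ (suc a) (suc a) refl))

isSucc-wrap : ∀ {m a} → suc a ≡ m → T (isSucc m a 0)
isSucc-wrap {a = a} refl = Equivalence.from T-∨ (inj₂ (Equivalence.from T-∧ (≡⇒≡ᵇ (suc a) (suc a) refl , _)))

isSucc-injective : ∀ m a a′ b → T (isSucc m a b) → T (isSucc m a′ b) → a ≡ a′
isSucc-injective m a a′ b s s′ with isSucc-view m a b s | isSucc-view m a′ b s′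
... | inj₁ p       | inj₁ q       = suc-injective (trans p (sym q))
... | inj₁ p       | inj₂ (_ , q) = contradiction (trans p q) λ ()
... | inj₂ (_ , p) | inj₁ q       = contradiction (trans q p) λ ()
... | inj₂ (p , _) | inj₂ (q , _) = suc-injective (trans p (sym q))

isSucc-functional : ∀ m a {b b′} → b < m → b′ < m → T (isSucc m a b) → T (isSucc m a b′) → b ≡ b′
isSucc-functional m a {b} {b′} b<m b′<m s s′ with isSucc-view m a b s | isSucc-view m a b′ s′
... | inj₁ p       | inj₁ q       = trans (sym p) q
... | inj₁ p       | inj₂ (q , _) = contradiction (trans (sym p) q) (<⇒≢ b<m)
... | inj₂ (p , _) | inj₁ q       = contradiction (trans (sym q) p) (<⇒≢ b′<m)
... | inj₂ (_ , p) | inj₂ (_ , q) = trans p (sym q)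

-- On two vertices each is the successor of the other; this is where n ≥ 3 enters the cycle.
isSucc-asym : ∀ n′ a b → T (isSucc (3 + n′) a b) → ¬ T (isSucc (3 + n′) b a)
isSucc-asym n′ a b s s′ with isSucc-view (3 + n′) a b s | isSucc-view (3 + n′) b a s′
... | inj₁ refl        | inj₁ q           = m≢1+n+m a (sym q)
... | inj₁ refl        | inj₂ (() , refl)
... | inj₂ (() , refl) | inj₁ refl
... | inj₂ (() , refl) | inj₂ (_ , refl)

predecessor : ∀ {m} (i : Fin m) → Σ (Fin m) λ p → T (isSucc m (toℕ p) (toℕ i))
predecessor {suc m} zero    = fromℕ m , isSucc-wrap (cong suc (toℕ-fromℕ m))
predecessor {suc m} (suc j) = inject₁ j , isSucc-step (suc m) (cong suc (toℕ-inject₁ j))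

successor : ∀ {m} (i : Fin m) → Σ (Fin m) λ q → T (isSucc m (toℕ i) (toℕ q))
successor {suc m} i with suc (toℕ i) ≟ suc m
... | yes wraps  = zero , isSucc-wrap wraps
... | no  ¬wraps = fromℕ< i+1<m , isSucc-step (suc m) (sym (toℕ-fromℕ< i+1<m))
  where
  i+1<m : suc (toℕ i) < suc m
  i+1<m = ≤∧≢⇒< (toℕ<n i) ¬wraps

module _ {n′ : ℕ} where
  private
    n = 3 + n′

  ∑-cycAdj-column : ∀ (i : Fin n) c → ∑[ r < n ] (if cycAdj n r i then c else 0) ≡ c + c
  ∑-cycAdj-column i c = begin
    ∑[ r < n ] (if cycAdj n r i then c else 0)
      ≡⟨ sum-cong-≗ {n} (λ r → if-∨ c (λ (s , s′) → isSucc-asym n′ (toℕ r) (toℕ i) s s′)) ⟩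
    ∑[ r < n ] (ind (before r) + ind (after r))
      ≡⟨ ∑-distrib-+ (ind ∘ before) (ind ∘ after) ⟩
    ∑[ r < n ] ind (before r) + ∑[ r < n ] ind (after r)
      ≡⟨ cong₂ _+_ (∑-indicator before c p p-before unique-p) (∑-indicator after c q q-after unique-q) ⟩
    c + c ∎
    where
    open ≡-Reasoning
    ind : Bool → ℕ
    ind b = if b then c else 0
    before after : Fin n → Bool
    before r = isSucc n (toℕ r) (toℕ i)
    after  r = isSucc n (toℕ i) (toℕ r)
    p = proj₁ (predecessor i)
    p-before = proj₂ (predecessor i)
    q = proj₁ (successor i)
    q-after = proj₂ (successor i)
    unique-p : ∀ r → T (before r) → r ≡ p
    unique-p r s = toℕ-injective (isSucc-injective n (toℕ r) (toℕ p) (toℕ i) s p-before)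
    unique-q : ∀ r → T (after r) → r ≡ q
    unique-q r s = toℕ-injective (isSucc-functional n (toℕ i) (toℕ<n r) (toℕ<n q) s q-after)

  ∑-cycAdj : (ψ : Fin n → ℕ) → ∑[ r < n ] ∑[ i < n ] (if cycAdj n r i then ψ i else 0) ≡ sum ψ + sum ψ
  ∑-cycAdj ψ = begin
    ∑[ r < n ] ∑[ i < n ] (if cycAdj n r i then ψ i else 0) ≡⟨ ∑-comm (λ r i → if cycAdj n r i then ψ i else 0) ⟩
    ∑[ i < n ] ∑[ r < n ] (if cycAdj n r i then ψ i else 0) ≡⟨ sum-cong-≗ (λ i → ∑-cycAdj-column i (ψ i)) ⟩
    ∑[ i < n ] (ψ i + ψ i)                                  ≡⟨ ∑-distrib-+ ψ ψ ⟩
    sum ψ + sum ψ ∎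
    where open ≡-Reasoning

module _ {n′ : ℕ} where
  private
    n = 3 + n′
    W = Wheel n

  nbrSum-Wheel-hub : (g : V W → ℕ) → nbrSum W g (inj₁ tt) ≡ ∑[ i < n ] g (inj₂ i)
  nbrSum-Wheel-hub g = sum-allFin (λ a → if adj W (inj₁ tt) (vertex W a) then g (vertex W a) else 0)

  nbrSum-Wheel-rim : (g : V W → ℕ) (r : Fin n) →
    nbrSum W g (inj₂ r) ≡ g (inj₁ tt) + ∑[ i < n ] (if cycAdj n r i then g (inj₂ i) else 0)
  nbrSum-Wheel-rim g r = sum-allFin (λ a → if adj W (inj₂ r) (vertex W a) then g (vertex W a) else 0)

  ∑-nbrSum-Wheel-rim : (g : V W → ℕ) →
    ∑[ r < n ] nbrSum W g (inj₂ r) ≡ n * g (inj₁ tt) + (nbrSum W g (inj₁ tt) + nbrSum W g (inj₁ tt))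
  ∑-nbrSum-Wheel-rim g = begin
    ∑[ r < n ] nbrSum W g (inj₂ r)
      ≡⟨ sum-cong-≗ (nbrSum-Wheel-rim g) ⟩
    ∑[ r < n ] (g (inj₁ tt) + ∑[ i < n ] (if cycAdj n r i then g (inj₂ i) else 0))
      ≡⟨ ∑-distrib-+ (λ _ → g (inj₁ tt)) (λ r → ∑[ i < n ] (if cycAdj n r i then g (inj₂ i) else 0)) ⟩
    ∑[ r < n ] g (inj₁ tt) + ∑[ r < n ] ∑[ i < n ] (if cycAdj n r i then g (inj₂ i) else 0)
      ≡⟨ cong₂ _+_ (∑-const n (g (inj₁ tt))) (∑-cycAdj (g ∘ inj₂)) ⟩
    n * g (inj₁ tt) + (∑[ i < n ] g (inj₂ i) + ∑[ i < n ] g (inj₂ i))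
      ≡⟨ cong (λ s → n * g (inj₁ tt) + (s + s)) (nbrSum-Wheel-hub g) ⟨
    n * g (inj₁ tt) + (nbrSum W g (inj₁ tt) + nbrSum W g (inj₁ tt)) ∎
    where open ≡-Reasoning

  nbrSum-Wheel-determines-hub : (g h : V W → ℕ) →
    (∀ v → nbrSum W g v ≡ nbrSum W h v) → g (inj₁ tt) ≡ h (inj₁ tt)
  nbrSum-Wheel-determines-hub g h same = *-cancelˡ-≡ _ _ n (+-cancelʳ-≡ _ _ _ (begin
    n * g (inj₁ tt) + (sg + sg)        ≡⟨ ∑-nbrSum-Wheel-rim g ⟨
    ∑[ r < n ] nbrSum W g (inj₂ r)     ≡⟨ sum-cong-≗ (same ∘ inj₂) ⟩
    ∑[ r < n ] nbrSum W h (inj₂ r)     ≡⟨ ∑-nbrSum-Wheel-rim h ⟩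
    n * h (inj₁ tt) + (sh + sh)        ≡⟨ cong (λ s → n * h (inj₁ tt) + (s + s)) (same (inj₁ tt)) ⟨
    n * h (inj₁ tt) + (sg + sg)        ∎))
    where
    open ≡-Reasoning
    sg = nbrSum W g (inj₁ tt)
    sh = nbrSum W h (inj₁ tt)

theorem2p11 : (t n : ℕ) → t ≥ 3 → n ≥ 3 → ¬ DistanceMagic (Mycielskian t (Wheel n))
theorem2p11 t@(suc (suc (suc _))) n@(suc (suc (suc _))) (s≤s (s≤s (s≤s _))) (s≤s (s≤s (s≤s _)))
            (f , (f-injective , _) , k , magic) =
  contradiction (f-injective (toℕ-injective (suc-injective hub₁≡hub₂))) λ ()
  where
  label : V (Mycielskian t (Wheel n)) → ℕ
  label w = suc (toℕ (f w))
  labelIn : Fin t → V (Wheel n) → ℕ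
  labelIn = layer t (Wheel n) label
  hub₁≡hub₂ : labelIn (suc zero) (inj₁ tt) ≡ labelIn (suc (suc zero)) (inj₁ tt)
  hub₁≡hub₂ = nbrSum-Wheel-determines-hub (labelIn (suc zero)) (labelIn (suc (suc zero)))
                (magic⇒nbrSum-layer₁≡nbrSum-layer₂ (Wheel n) label k magic)
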